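{- Let $G$ be a vertex-colored graph, $T$ a colorful tree, and $H = \textsc{mcg}(G,T)$. Let $v \in V_T$ be a leaf of $T$ and let $\mathcal{V} = \{w \in V_H : c(w) = c(v)\}$. Then $\textsc{mcg}(H, T - \{v\})$ returns $H - \mathcal{V}$.
   Context: A vertex-colored graph is a finite simple undirected graph with a color function $c$ on its vertices; it is colorful if $c$ is injective on its vertices. For a vertex set $X$, $H - X$ is the subgraph induced by the remaining vertices; for an edge set $F$, $H - F$ removes those edges. Algorithm \textsc{mcg}$(G,T)$ (input: vertex-colored graph $G$, colorful tree $T$): set $H := G$; delete from $H$ every vertex whose color is not the color of some vertex of $T$; delete from $H$ every edge $vv'$ for which there is no edge $ww' \in E_T$ with $c(v) = c(w)$ and $c(v') = c(w')$; then, while there exist $v \in V_H$ and $w, w' \in V_T$ with $c(v) = c(w)$, $ww' \in E_T$, such that no $v' \in V_H$ satisfies $vv' \in E_H$ and $c(v') = c(w')$, delete $v$ (and its incident edges) from $H$; finally return $H$. -}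

module Defs where

open import Data.Nat using (ℕ)
open import Data.Fin using (Fin)
open import Data.Fin.Properties using () renaming (_≟_ to _≟ᶠ_)
open import Data.Bool using (Bool; true; false; _∧_; not)
open import Data.List using (List; []; _∷_; allFin; _∷ʳ_)
open import Data.Bool.ListAction using (any)
open import Data.List.Relation.Unary.Linked using (Linked)
open import Data.List.Relation.Unary.Unique.Propositional using (Unique)
open import Data.Product using (Σ; _×_; ∃; ∃-syntax)
open import Relation.Nullary using (¬_)
open import Relation.Nullary.Decidable using (⌊_⌋)
open import Relation.Binary.Definitions using (DecidableEquality)
open import Relation.Binary.PropositionalEquality using (_≡_)
open import Relation.Binary.Construct.Closure.ReflexiveTransitive using (Star)

-- A graph whose vertices are drawn from the ambient finite set Fin n:
-- V x = true iff x is a vertex; E x y = true iff xy is an edge.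
record Graph (n : ℕ) : Set where
  constructor mkGraph
  field
    V : Fin n → Bool
    E : Fin n → Fin n → Bool
open Graph public

record WellFormed {n : ℕ} (G : Graph n) : Set where
  field
    edge-vertices : ∀ x y → E G x y ≡ true → (V G x ≡ true) × (V G y ≡ true)
    symmetric     : ∀ x y → E G x y ≡ E G y x
    loopless      : ∀ x → E G x x ≡ false
open WellFormed public

Adj : {n : ℕ} → Graph n → Fin n → Fin n → Set
Adj G x y = E G x y ≡ true

_≅_ : {n : ℕ} → Graph n → Graph n → Set
G ≅ H = (∀ x → V G x ≡ V H x) × (∀ x y → E G x y ≡ E H x y)

deleteVertices : {n : ℕ} → Graph n → (Fin n → Bool) → Graph n
deleteVertices G X = mkGraph (λ x → V G x ∧ not (X x))
                             (λ x y → E G x y ∧ not (X x) ∧ not (X y))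

deleteVertex : {n : ℕ} → Graph n → Fin n → Graph n
deleteVertex G v = deleteVertices G (λ x → ⌊ x ≟ᶠ v ⌋)

Connected : {n : ℕ} → Graph n → Set
Connected G = ∀ x y → V G x ≡ true → V G y ≡ true → Star (Adj G) x y

HasCycle : {n : ℕ} → Graph n → Set
HasCycle {n} G = Σ (Fin n) λ x → Σ (Fin n) λ y → Σ (Fin n) λ z → Σ (List (Fin n)) λ rest →
  Unique (x ∷ y ∷ z ∷ rest) × Linked (Adj G) ((x ∷ y ∷ z ∷ rest) ∷ʳ x)

IsTree : {n : ℕ} → Graph n → Set
IsTree G = WellFormed G × Connected G × ¬ HasCycle G

IsLeaf : {n : ℕ} → Graph n → Fin n → Set
IsLeaf G v = V G v ≡ true × Σ _ λ u → Adj G v u × (∀ u' → Adj G v u' → u' ≡ u)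

Colorful : {m : ℕ} {C : Set} → Graph m → (Fin m → C) → Set
Colorful T c = ∀ x y → V T x ≡ true → V T y ≡ true → c x ≡ c y → x ≡ y

module MCG {C : Set} (_≟_ : DecidableEquality C) where

  _==_ : C → C → Bool
  a == b = ⌊ a ≟ b ⌋

  colorInT : {m : ℕ} → Graph m → (Fin m → C) → C → Bool
  colorInT {m} T cT k = any (λ w → V T w ∧ (cT w == k)) (allFin m)

  edgeColorsInT : {m : ℕ} → Graph m → (Fin m → C) → C → C → Bool
  edgeColorsInT {m} T cT a b =
    any (λ w → any (λ w' → E T w w' ∧ (cT w == a) ∧ (cT w' == b)) (allFin m)) (allFin m)

  step1 : {n m : ℕ} → Graph n → (Fin n → C) → Graph m → (Fin m → C) → Graph n
  step1 G c T cT = deleteVertices G (λ x → not (colorInT T cT (c x)))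

  step2 : {n m : ℕ} → Graph n → (Fin n → C) → Graph m → (Fin m → C) → Graph n
  step2 H c T cT = mkGraph (V H) (λ x y → E H x y ∧ edgeColorsInT T cT (c x) (c y))

  -- the while-loop condition for a vertex v of H
  Deletable : {n m : ℕ} → Graph n → (Fin n → C) → Graph m → (Fin m → C) → Fin n → Set
  Deletable H c T cT v =
    V H v ≡ true × Σ _ λ w → Σ _ λ w' →
      V T w ≡ true × c v ≡ cT w × Adj T w w' ×
      ¬ (Σ _ λ v' → V H v' ≡ true × Adj H v v' × c v' ≡ cT w')

  -- Prune H H' : some execution of the while loop started at H terminates with H'
  data Prune {n m : ℕ} (c : Fin n → C) (T : Graph m) (cT : Fin m → C) :
             Graph n → Graph n → Set where
    done : ∀ {H} → (∀ v → ¬ Deletable H c T cT v) → Prune c T cT H H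
    step : ∀ {H H'} v → Deletable H c T cT v →
           Prune c T cT (deleteVertex H v) H' → Prune c T cT H H'

  -- Returns G c T cT H : some execution of mcg(G,T) returns H
  Returns : {n m : ℕ} → Graph n → (Fin n → C) → Graph m → (Fin m → C) → Graph n → Set
  Returns G c T cT H = Prune c T cT (step2 (step1 G c T cT) c T cT) H

-- Every vertex and edge of H = mcg(G,T) carries the colors of a vertex,
-- resp. an edge, of T. As T is colorful, the first two steps of mcg(H, T - {v}) therefore remove
-- exactly the vertices of color c(v), giving H - 𝒱. Any vertex deletable in H - 𝒱 with respect
-- to T - {v} would already be deletable in H with respect to T, so the while loop stops at once.
module Submission where

open import Defs
open import Data.Nat using (ℕ)
open import Data.Fin using (Fin)
open import Data.Fin.Properties using () renaming (_≟_ to _≟ᶠ_)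
open import Data.Bool using (Bool; true; false; _∧_; not)
open import Data.Bool.Properties using (T-≡; ¬-not; not-involutive)
open import Data.Bool.ListAction using (any)
open import Data.List using (allFin)
open import Data.List.Relation.Unary.Any using (satisfied)
open import Data.List.Relation.Unary.Any.Properties using (any⁺; any⁻)
open import Data.List.Membership.Propositional using (lose)
open import Data.List.Membership.Propositional.Properties using (∈-allFin)
open import Data.Product using (∃; ∃₂; _×_; _,_; proj₁; proj₂)
open import Function.Bundles using (Equivalence)
open import Relation.Nullary using (¬_; Dec; yes; no)
open import Relation.Nullary.Decidable using (⌊_⌋; isYes≗does; dec-true; dec-false; toWitness)
open import Relation.Binary.Definitions using (DecidableEquality)
open import Relation.Binary.PropositionalEquality
  using (_≡_; _≢_; refl; sym; trans; cong; cong₂; subst)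

∧-true⁻ : ∀ {x y} → x ∧ y ≡ true → x ≡ true × y ≡ true
∧-true⁻ {true} y≡true = refl , y≡true

∧-true⁺ : ∀ {x y} → x ≡ true → y ≡ true → x ∧ y ≡ true
∧-true⁺ refl y≡true = y≡true

∧-congʳ-if : ∀ {x y z} → (x ≡ true → y ≡ z) → x ∧ y ≡ x ∧ z
∧-congʳ-if {true}  y≡z = y≡z refl
∧-congʳ-if {false} _   = refl

∧-absorbʳ-if : ∀ {x y} → (x ≡ true → y ≡ true) → x ∧ y ≡ x
∧-absorbʳ-if {true}  y≡true = y≡true refl
∧-absorbʳ-if {false} _      = refl

module _ {A : Set} (a? : Dec A) where

  ⌊⌋-true : A → ⌊ a? ⌋ ≡ true
  ⌊⌋-true a = trans (isYes≗does a?) (dec-true a? a)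

  ⌊⌋-true⇒ : ⌊ a? ⌋ ≡ true → A
  ⌊⌋-true⇒ h = toWitness (Equivalence.from T-≡ h)

  not-⌊⌋-true⇒¬ : not ⌊ a? ⌋ ≡ true → ¬ A
  not-⌊⌋-true⇒¬ h a with () ← trans (sym h) (cong not (⌊⌋-true a))

  ¬⇒not-⌊⌋-true : ¬ A → not ⌊ a? ⌋ ≡ true
  ¬⇒not-⌊⌋-true ¬a = cong not (trans (isYes≗does a?) (dec-false a? ¬a))

any-allFin⁺ : ∀ {m} (p : Fin m → Bool) x → p x ≡ true → any p (allFin m) ≡ true
any-allFin⁺ p x px =
  Equivalence.to T-≡ (any⁺ p (lose (∈-allFin x) (Equivalence.from T-≡ px)))

any-allFin⁻ : ∀ {m} (p : Fin m → Bool) → any p (allFin m) ≡ true → ∃ λ x → p x ≡ true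
any-allFin⁻ {m} p h with x , px ← satisfied (any⁻ p (allFin m) (Equivalence.from T-≡ h)) =
  x , Equivalence.to T-≡ px

module _ {C : Set} (_≟_ : DecidableEquality C) where
  open MCG _≟_

  module _ {m : ℕ} (T : Graph m) (cT : Fin m → C) where

    colorInT⁺ : ∀ {w k} → V T w ≡ true → cT w ≡ k → colorInT T cT k ≡ true
    colorInT⁺ {w} vw refl = any-allFin⁺ _ w (∧-true⁺ vw (⌊⌋-true (cT w ≟ cT w) refl))

    colorInT⁻ : ∀ {k} → colorInT T cT k ≡ true → ∃ λ w → V T w ≡ true × cT w ≡ k
    colorInT⁻ {k} h with w , h' ← any-allFin⁻ _ h
                    with vw , cw ← ∧-true⁻ h' = w , vw , ⌊⌋-true⇒ (cT w ≟ k) cw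

    edgeColorsInT⁺ : ∀ {w w' a b} → Adj T w w' → cT w ≡ a → cT w' ≡ b →
                     edgeColorsInT T cT a b ≡ true
    edgeColorsInT⁺ {w} {w'} ww' refl refl =
      any-allFin⁺ _ w (any-allFin⁺ _ w'
        (∧-true⁺ ww' (∧-true⁺ (⌊⌋-true (cT w ≟ cT w) refl) (⌊⌋-true (cT w' ≟ cT w') refl))))

    edgeColorsInT⁻ : ∀ {a b} → edgeColorsInT T cT a b ≡ true →
                     ∃₂ λ w w' → Adj T w w' × cT w ≡ a × cT w' ≡ b
    edgeColorsInT⁻ {a} {b} h with w , h' ← any-allFin⁻ _ h
                             with w' , h'' ← any-allFin⁻ _ h'
                             with ww' , cs ← ∧-true⁻ h''
                             with cw , cw' ← ∧-true⁻ cs =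
      w , w' , ww' , ⌊⌋-true⇒ (cT w ≟ a) cw , ⌊⌋-true⇒ (cT w' ≟ b) cw'

  Deletable-resp-≅ : ∀ {n m} {c : Fin n → C} {T : Graph m} {cT : Fin m → C} {K K' : Graph n} →
                     K ≅ K' → ∀ {u} → Deletable K c T cT u → Deletable K' c T cT u
  Deletable-resp-≅ (V≡ , E≡) {u} (vu , w , w' , vw , cu , ww' , noNeighbour) =
    trans (sym (V≡ u)) vu , w , w' , vw , cu , ww' , λ (u' , vu' , uu' , cu') →
      noNeighbour (u' , trans (V≡ u') vu' , trans (E≡ u u') uu' , cu')

  Prune-stuck : ∀ {n m} {c : Fin n → C} {T : Graph m} {cT : Fin m → C} {K K' : Graph n} →
                (∀ u → ¬ Deletable K c T cT u) → Prune c T cT K K' → K' ≡ K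
  Prune-stuck _     (done _)     = refl
  Prune-stuck stuck (step u d _) with () ← stuck u d

  Prune-final : ∀ {n m} {c : Fin n → C} {T : Graph m} {cT : Fin m → C} {K K' : Graph n} →
                Prune c T cT K K' → ∀ u → ¬ Deletable K' c T cT u
  Prune-final (done stuck)  = stuck
  Prune-final (step _ _ P)  = Prune-final P

  record ColoredBy {n m : ℕ} (H : Graph n) (c : Fin n → C) (T : Graph m) (cT : Fin m → C) : Set where
    field
      vertex-colors : ∀ x → V H x ≡ true → colorInT T cT (c x) ≡ true
      edge-colors   : ∀ x y → E H x y ≡ true → edgeColorsInT T cT (c x) (c y) ≡ true
  open ColoredBy

  module _ {n m : ℕ} {c : Fin n → C} {T : Graph m} {cT : Fin m → C} where

    ColoredBy-step2-step1 : ∀ G → ColoredBy (step2 (step1 G c T cT) c T cT) c T cT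
    vertex-colors (ColoredBy-step2-step1 G) x h =
      trans (sym (not-involutive _)) (proj₂ (∧-true⁻ h))
    edge-colors (ColoredBy-step2-step1 G) x y h = proj₂ (∧-true⁻ {E (step1 G c T cT) x y} h)

    ColoredBy-deleteVertices : ∀ {H} X → ColoredBy H c T cT → ColoredBy (deleteVertices H X) c T cT
    vertex-colors (ColoredBy-deleteVertices X col) x h = vertex-colors col x (proj₁ (∧-true⁻ h))
    edge-colors (ColoredBy-deleteVertices X col) x y h = edge-colors col x y (proj₁ (∧-true⁻ h))

    ColoredBy-Prune : ∀ {H H'} → ColoredBy H c T cT → Prune c T cT H H' → ColoredBy H' c T cT
    ColoredBy-Prune col (done _)     = col
    ColoredBy-Prune col (step _ _ P) = ColoredBy-Prune (ColoredBy-deleteVertices _ col) P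

    ColoredBy-Returns : ∀ G {H} → Returns G c T cT H → ColoredBy H c T cT
    ColoredBy-Returns G = ColoredBy-Prune (ColoredBy-step2-step1 G)

  module DeleteColorfulVertex {m : ℕ} (T : Graph m) (cT : Fin m → C)
           (wfT : WellFormed T) (colorful : Colorful T cT) {v : Fin m} (vT : V T v ≡ true) where

    T' : Graph m
    T' = deleteVertex T v

    colorInT-deleteVertex : ∀ {k} → colorInT T cT k ≡ true →
                            colorInT T' cT k ≡ not (k == cT v)
    colorInT-deleteVertex {k} h with k ≟ cT v
    ... | yes k≡cv = ¬-not λ h' →
      let w , vw' , cw = colorInT⁻ T' cT h'
          vw , w≢v = ∧-true⁻ vw'
      in not-⌊⌋-true⇒¬ (w ≟ᶠ v) w≢v (colorful w v vw vT (trans cw k≡cv))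
    ... | no k≢cv =
      let w , vw , cw = colorInT⁻ T cT h
      in colorInT⁺ T' cT (∧-true⁺ vw (¬⇒not-⌊⌋-true (w ≟ᶠ v) λ { refl → k≢cv (sym cw) })) cw

    edgeColorsInT-deleteVertex : ∀ {a b} → edgeColorsInT T cT a b ≡ true →
                                 a ≢ cT v → b ≢ cT v → edgeColorsInT T' cT a b ≡ true
    edgeColorsInT-deleteVertex h a≢cv b≢cv =
      let w , w' , ww' , cw , cw' = edgeColorsInT⁻ T cT h
          kept : ∀ {u k} → cT u ≡ k → k ≢ cT v → not ⌊ u ≟ᶠ v ⌋ ≡ true
          kept {u} cu k≢cv = ¬⇒not-⌊⌋-true (u ≟ᶠ v) λ { refl → k≢cv (sym cu) }
      in edgeColorsInT⁺ T' cT (∧-true⁺ ww' (∧-true⁺ (kept cw a≢cv) (kept cw' b≢cv))) cw cw'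

    module _ {n : ℕ} {c : Fin n → C} {H : Graph n} (col : ColoredBy H c T cT) where

      H-𝒱 : Graph n
      H-𝒱 = deleteVertices H (λ x → c x == cT v)

      kept-color : ∀ {x} → colorInT T cT (c x) ≡ true →
                   not (not (colorInT T' cT (c x))) ≡ not (c x == cT v)
      kept-color h = trans (not-involutive _) (colorInT-deleteVertex h)

      edge-endpoint-colors : ∀ {x y} → E H x y ≡ true →
                             colorInT T cT (c x) ≡ true × colorInT T cT (c y) ≡ true
      edge-endpoint-colors {x} {y} h =
        let w , w' , ww' , cw , cw' = edgeColorsInT⁻ T cT (edge-colors col x y h)
            vw , vw' = edge-vertices wfT w w' ww'
        in colorInT⁺ T cT vw cw , colorInT⁺ T cT vw' cw'

      step2-step1-deleteVertex : step2 (step1 H c T' cT) c T' cT ≅ H-𝒱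
      step2-step1-deleteVertex =
        (λ x → ∧-congʳ-if λ vx → kept-color (vertex-colors col x vx)) ,
        λ x y → trans
          (cong (_∧ edgeColorsInT T' cT (c x) (c y)) (∧-congʳ-if λ exy →
            let cx , cy = edge-endpoint-colors exy in cong₂ _∧_ (kept-color cx) (kept-color cy)))
          (∧-absorbʳ-if λ h →
            let exy , keep = ∧-true⁻ h
                keepx , keepy = ∧-true⁻ keep
            in edgeColorsInT-deleteVertex (edge-colors col x y exy)
                 (not-⌊⌋-true⇒¬ (c x ≟ cT v) keepx) (not-⌊⌋-true⇒¬ (c y ≟ cT v) keepy))

      -- A neighbour witnessing the non-deletability of u in H has a color of T - {v},
      -- so it survives in H - 𝒱.
      Deletable-deleteVertex : ∀ {u} → Deletable H-𝒱 c T' cT u → Deletable H c T cT u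
      Deletable-deleteVertex {u} (vu , w , w' , vw , cu , ww' , noNeighbour) =
        let vHu , keepu = ∧-true⁻ vu
            Eww' , keepw = ∧-true⁻ ww'
            vTw' = proj₂ (edge-vertices wfT w w' Eww')
            w'≢v = not-⌊⌋-true⇒¬ (w' ≟ᶠ v) (proj₂ (∧-true⁻ keepw))
        in vHu , w , w' , proj₁ (∧-true⁻ vw) , cu , Eww' , λ (u' , vu' , uu' , cu') →
          let keepu' = ¬⇒not-⌊⌋-true (c u' ≟ cT v) λ cu'≡cv →
                         w'≢v (colorful w' v vTw' vT (trans (sym cu') cu'≡cv))
          in noNeighbour (u' , ∧-true⁺ vu' keepu' , ∧-true⁺ uu' (∧-true⁺ keepu keepu') , cu')

lemma1 : {C : Set} (_≟_ : DecidableEquality C) {n m : ℕ}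
         (G : Graph n) (c : Fin n → C) (T : Graph m) (cT : Fin m → C) →
         WellFormed G → IsTree T → Colorful T cT →
         (H : Graph n) → MCG.Returns _≟_ G c T cT H →
         (v : Fin m) → IsLeaf T v →
         (H' : Graph n) → MCG.Returns _≟_ H c (deleteVertex T v) cT H' →
         H' ≅ deleteVertices H (λ w → MCG._==_ _≟_ (c w) (cT v))
lemma1 _≟_ G c T cT _ (wfT , _) colorful H returnsH v (vT , _) H' returnsH' =
  subst (_≅ H-𝒱 colH) (sym H'≡K) (step2-step1-deleteVertex colH)
  where
    open MCG _≟_
    open DeleteColorfulVertex _≟_ T cT wfT colorful vT
    colH : ColoredBy _≟_ H c T cT
    colH = ColoredBy-Returns _≟_ G returnsH
    H'≡K : H' ≡ step2 (step1 H c T' cT) c T' cT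
    H'≡K = Prune-stuck _≟_
      (λ u d → Prune-final _≟_ returnsH u
        (Deletable-deleteVertex colH (Deletable-resp-≅ _≟_ (step2-step1-deleteVertex colH) d)))
      returnsH'
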